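{- Let $\mathcal{G}_r$ be a path $\bar u_1,\dots,\bar u_{n_r}$ and $\mathcal{G}_s$ a cycle, with capacities and costs as in C-uniVNE, and suppose a feasible mapping of $\mathcal{G}_r$ on $\mathcal{G}_s$ exists. Then there is a minimum-cost feasible mapping of $\mathcal{G}_r$ on $\mathcal{G}_s$ that is an elementary path mapping.
   Context: Uniform-demand Virtual Network Embedding (uniVNE). A virtual graph $\mathcal{G}_r=(V_r,E_r)$ ($n_r$ nodes) and a substrate graph $\mathcal{G}_s=(V_s,E_s)$ ($n_s$ nodes) with capacities $c(u)\in\mathbb{N}^+$ for $u\in V_s$ and $c(e)\in\mathbb{N}^+$ for $e\in E_s$, and nonnegative integer costs $w(u)$, $w(e)$, are given. A mapping is a pair $m=(m_V,m_E)$ where $m_V:V_r\to V_s$ and $m_E$ assigns to each virtual edge $(\bar u,\bar v)\in E_r$ a loop-free path of $\mathcal{G}_s$ connecting $m_V(\bar u)$ and $m_V(\bar v)$ (the empty path if these coincide). It is feasible if every $u\in V_s$ satisfies $|m_V^{ -1}(u)|\le c(u)$ and every $e\in E_s$ belongs to at most $c(e)$ of the paths $m_E(\bar e)$. Its cost is $\sum_{\bar u\in V_r} w(m_V(\bar u))+\sum_{\bar e\in E_r}\sum_{e\in m_E(\bar e)} w(e)$. For a virtual path $\bar u_1,\dots,\bar u_{n_r}$ mapped on a cycle, the mapping is an elementary path mapping if the walk in $\mathcal{G}_s$ obtained by concatenating $m_E(\bar u_1,\bar u_2), m_E(\bar u_2,\bar u_3),\dots,m_E(\bar u_{n_r-1},\bar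 u_{n_r})$ is an elementary path of $\mathcal{G}_s$, i.e. every substrate node appears at most once in it. -}

module Defs where

open import Data.Nat using (ℕ; zero; suc; _+_; _≤_)
open import Data.Nat.DivMod using (_mod_)
open import Data.Fin using (Fin; toℕ; inject₁) renaming (suc to fsuc; _≟_ to _≟F_)
open import Data.List using (List; []; _∷_; _++_; map; concat; drop; length; filter; head; last)
open import Data.Nat.ListAction using (sum)
open import Data.List.Relation.Unary.Linked using (Linked)
open import Data.List.Relation.Unary.Unique.Propositional using (Unique)
open import Data.List.Membership.Propositional using (_∈_)
import Data.List.Membership.DecPropositional as DecMem
open import Data.Fin.Base using () 
open import Data.List.Base using ()
open import Data.Maybe using (Maybe; just)
open import Data.Product using (Σ; _×_; _,_)
open import Data.Sum using (_⊎_)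
open import Data.Bool using (if_then_else_)
open import Relation.Nullary using (does)
open import Relation.Binary.PropositionalEquality using (_≡_; _≢_)

-- Substrate: the cycle C_{n_s} with n_s = suc m nodes, nodes Fin (suc m).
-- Substrate edge e : Fin (suc m) is the edge {e , next e}.

next : (m : ℕ) → Fin (suc m) → Fin (suc m)
next m i = suc (toℕ i) mod (suc m)

Adj : (m : ℕ) → Fin (suc m) → Fin (suc m) → Set
Adj m x y = (next m x ≡ y) ⊎ (next m y ≡ x)

edgeOf : (m : ℕ) → Fin (suc m) → Fin (suc m) → Fin (suc m)
edgeOf m x y = if does (next m x ≟F y) then x else y

-- The empty path
-- (a = b) is the one-node sequence a ∷ [].
record IsPath (m : ℕ) (a b : Fin (suc m)) (p : List (Fin (suc m))) : Set where
  field
    startsAt : head p ≡ just a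
    endsAt   : last p ≡ just b
    linked   : Linked (Adj m) p
    loopFree : Unique p

pathEdges : (m : ℕ) → List (Fin (suc m)) → List (Fin (suc m))
pathEdges m (x ∷ y ∷ r) = edgeOf m x y ∷ pathEdges m (y ∷ r)
pathEdges m _           = []

-- Virtual graph: the path ū_0, ..., ū_p (n_r = suc p nodes, Fin (suc p));
-- virtual edge j : Fin p joins inject₁ j and fsuc j.

record Mapping (p m : ℕ) : Set where
  field
    mV     : Fin (suc p) → Fin (suc m)
    mE     : Fin p → List (Fin (suc m))
    mEpath : (j : Fin p) → IsPath m (mV (inject₁ j)) (mV (fsuc j)) (mE j)
open Mapping public

allFin : (k : ℕ) → List (Fin k)
allFin k = Data.List.Base.tabulate (λ i → i)
  where import Data.List.Base

nodeLoad : {p m : ℕ} → Mapping p m → Fin (suc m) → ℕ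
nodeLoad {p} M u = length (filter (λ k → mV M k ≟F u) (allFin (suc p)))

edgeLoad : {p m : ℕ} → Mapping p m → Fin (suc m) → ℕ
edgeLoad {p} {m} M e = length (filter (λ j → DecMem._∈?_ (_≟F_ {suc m}) e (pathEdges m (mE M j))) (allFin p))

Feasible : {p m : ℕ} → (cN cE : Fin (suc m) → ℕ) → Mapping p m → Set
Feasible cN cE M = (∀ u → nodeLoad M u ≤ cN u) × (∀ e → edgeLoad M e ≤ cE e)

cost : {p m : ℕ} → (wN wE : Fin (suc m) → ℕ) → Mapping p m → ℕ
cost {p} {m} wN wE M =
  sum (map (λ k → wN (mV M k)) (allFin (suc p)))
  + sum (map (λ j → sum (map wE (pathEdges m (mE M j)))) (allFin p))

walk : {p m : ℕ} → Mapping p m → List (Fin (suc m))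
walk {p} M = mV M Fin.zero ∷ concat (map (λ j → drop 1 (mE M j)) (allFin p))
  where import Data.Fin as Fin

ElementaryPathMapping : {p m : ℕ} → Mapping p m → Set
ElementaryPathMapping M = Unique (walk M)

{-# OPTIONS --safe #-}
module Submission where

-- Take a feasible mapping M′. Every node of the cycle has only two neighbours, so when the nodes
-- of its walk are collected from the back, a node not yet collected is adjacent to an endpoint of
-- the path collected so far: the walk's nodes form an elementary path E of the cycle using only
-- edges of the walk. Now put ū₀, …, ū_p on E at the positions of the old images sorted in
-- increasing order, and map each virtual edge to the segment of E between its ends. This is an
-- elementary path mapping with the same multiset of node images (so the same node loads and node
-- cost as M′) whose edges are pairwise distinct edges of the walk of M′ (so edge loads are at most
-- 1 ≤ c(e) and the edge cost is at most that of M′). Such mappings are determined by E and the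
-- sorted positions, hence range over a finite list, and its cheapest feasible member is optimal.

open import Defs

open import Data.Nat using (ℕ; zero; suc; _+_; _≤_; _<_; _≤?_; _<?_; s≤s; z≤n; z<s; _%_)
  renaming (_≟_ to _≟ℕ_)
open import Data.Nat.Properties
  using ( suc-injective; m≤n⇒m<n∨m≡n; <⇒≢; <-trans; m≢1+n+m; ≤-refl; ≤-trans; ≤-reflexive; <⇒≤
        ; <-≤-trans; +-monoʳ-≤; +-mono-≤; ≤-decTotalOrder; ≤-totalOrder; module ≤-Reasoning)
open import Data.Nat.DivMod using (m<n⇒m%n≡m; n%n≡0)
open import Data.Nat.ListAction using (sum)
open import Data.Nat.ListAction.Properties using (sum-++; sum-↭)
open import Data.Fin using (Fin; toℕ; inject₁) renaming (zero to fzero; suc to fsuc; _≟_ to _≟F_)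
open import Data.Fin.Properties using (toℕ-fromℕ<; toℕ-injective; toℕ≤pred[n]; toℕ-inject₁; toℕ<n; all?)
open import Data.List
  using (List; []; _∷_; _++_; _∷ʳ_; map; concat; concatMap; drop; head; last; length; lookup; filter; tabulate; upTo)
open import Data.List.Properties using (map-++; map-∘; map-cong; map-tabulate; length-map; length-tabulate)
open import Data.List.Relation.Unary.Linked as Linked using (Linked; []; [-]; _∷_; linked?)
import Data.List.Relation.Unary.Linked.Properties as Linkedₚ
open import Data.List.Relation.Unary.Unique.Propositional using (Unique)
open import Data.List.Relation.Unary.Unique.Propositional.Properties as Uniqueₚ using (Unique[x∷xs]⇒x∉xs)
import Data.List.Relation.Unary.Unique.DecPropositional as UniqueDec
open import Data.List.Relation.Unary.AllPairs using ([]; _∷_)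
open import Data.List.Relation.Unary.All as All using (All; []; _∷_)
open import Data.List.Relation.Unary.All.Properties using (¬Any⇒All¬; All¬⇒¬Any; anti-mono)
  renaming (map⁺ to All-map⁺)
open import Data.List.Relation.Unary.Any as Any using (here; there; index)
open import Data.List.Relation.Unary.Any.Properties using (lookup-index)
open import Data.List.Membership.Propositional using (_∈_; _∉_; lose)
open import Data.List.Membership.Propositional.Properties
  using (∈-∃++; ∈-++⁺ˡ; ∈-++⁺ʳ; ∈-++⁻; ∈-allFin; ∈-concatMap⁺; ∈-map⁺; ∈-upTo⁺; ∈-filter⁺; ∈-filter⁻)
import Data.List.Membership.DecPropositional as DecMembership
open import Data.List.Relation.Binary.Subset.Propositional using (_⊆_)
open import Data.List.Relation.Binary.Permutation.Propositional using (_↭_; ↭-sym; module PermutationReasoning)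
open import Data.List.Relation.Binary.Permutation.Propositional.Properties
  using (shift; map⁺; ↭-length; filter-↭; All-resp-↭)
open import Data.List.Sort ≤-decTotalOrder using (sort; sort-↭; sort-↗)
open import Data.List.Extrema ≤-totalOrder using (argmin; argmin-all; f[argmin]≤f[xs])
open import Data.Maybe using (just)
open import Data.Maybe.Relation.Binary.Connected using (Connected; just)
open import Data.Product using (Σ; ∃; _×_; _,_; proj₁; proj₂)
open import Data.Sum using (_⊎_; inj₁; inj₂; [_,_]′)
open import Data.Empty using (⊥; ⊥-elim)
open import Function using (_∘_; id)
open import Relation.Nullary using (Dec; yes; no)
open import Relation.Nullary.Decidable using (map′; _×-dec_; _⊎-dec_)
open import Relation.Unary using (Decidable)
open import Relation.Binary using (DecidableEquality)
open import Relation.Binary.PropositionalEquality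

private variable
  A B : Set
  R : A → A → Set
  m p : ℕ
  x y z a b c : Fin (suc m)
  xs ys : List A
  P W : List (Fin (suc m))

module _ (w : A → ℕ) where

  sum-map-concat : (xss : List (List A)) → sum (map w (concat xss)) ≡ sum (map (sum ∘ map w) xss)
  sum-map-concat []         = refl
  sum-map-concat (xs ∷ xss) = begin
    sum (map w (xs ++ concat xss))             ≡⟨ cong sum (map-++ w xs (concat xss)) ⟩
    sum (map w xs ++ map w (concat xss))       ≡⟨ sum-++ (map w xs) _ ⟩
    sum (map w xs) + sum (map w (concat xss))  ≡⟨ cong (sum (map w xs) +_) (sum-map-concat xss) ⟩
    sum (map w xs) + sum (map (sum ∘ map w) xss) ∎
    where open ≡-Reasoning

  sum-map-mono-⊆ : {xs ys : List A} → Unique xs → xs ⊆ ys → sum (map w xs) ≤ sum (map w ys)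
  sum-map-mono-⊆ {[]}     _          _     = z≤n
  sum-map-mono-⊆ {x ∷ xs} (x∉ ∷ uxs) xs⊆ys with ∈-∃++ (xs⊆ys (here refl))
  ... | ys₁ , ys₂ , refl = begin
    w x + sum (map w xs)           ≤⟨ +-monoʳ-≤ (w x) (sum-map-mono-⊆ uxs xs⊆ys₁ys₂) ⟩
    w x + sum (map w (ys₁ ++ ys₂)) ≡⟨ sum-↭ (map⁺ w (↭-sym (shift x ys₁ ys₂))) ⟩
    sum (map w (ys₁ ++ x ∷ ys₂))   ∎
    where
      open ≤-Reasoning
      xs⊆ys₁ys₂ : xs ⊆ ys₁ ++ ys₂
      xs⊆ys₁ys₂ {z} z∈ with ∈-++⁻ ys₁ (xs⊆ys (there z∈))
      ... | inj₁ z∈ys₁        = ∈-++⁺ˡ z∈ys₁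
      ... | inj₂ (here refl)  = ⊥-elim (All.lookup x∉ z∈ refl)
      ... | inj₂ (there z∈ys₂) = ∈-++⁺ʳ ys₁ z∈ys₂

sum-map-const-1 : (xs : List A) → sum (map (λ _ → 1) xs) ≡ length xs
sum-map-const-1 []       = refl
sum-map-const-1 (_ ∷ xs) = cong suc (sum-map-const-1 xs)

Unique⇒length≤ : {n : ℕ} {xs : List (Fin n)} → Unique xs → length xs ≤ n
Unique⇒length≤ {n} {xs} u = begin
  length xs                        ≡⟨ sum-map-const-1 xs ⟨
  sum (map (λ _ → 1) xs)           ≤⟨ sum-map-mono-⊆ (λ _ → 1) u (λ {i} _ → ∈-allFin i) ⟩
  sum (map (λ _ → 1) (allFin n))   ≡⟨ sum-map-const-1 (allFin n) ⟩
  length (allFin n)                ≡⟨ length-tabulate (λ i → i) ⟩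
  n                                ∎
  where open ≤-Reasoning

module _ {P : A → Set} (P? : Decidable P) (f : B → A) where

  length-filter-map : (xs : List B) → length (filter P? (map f xs)) ≡ length (filter (P? ∘ f) xs)
  length-filter-map []       = refl
  length-filter-map (x ∷ xs) with P? (f x)
  ... | yes _ = cong suc (length-filter-map xs)
  ... | no _  = length-filter-map xs

Unique-++⁻ʳ : (xs : List A) {ys : List A} → Unique (xs ++ ys) → Unique ys
Unique-++⁻ʳ []       u       = u
Unique-++⁻ʳ (_ ∷ xs) (_ ∷ u) = Unique-++⁻ʳ xs u

Unique-++⇒∉ : (xs : List A) {ys : List A} {a : A} → Unique (xs ++ ys) → a ∈ xs → a ∉ ys
Unique-++⇒∉ (_ ∷ xs) (x∉ ∷ _) (here refl) a∈ys = All.lookup x∉ (∈-++⁺ʳ xs a∈ys) refl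
Unique-++⇒∉ (_ ∷ xs) (_ ∷ u)  (there a∈)  = Unique-++⇒∉ xs u a∈

module _ (_≟_ : DecidableEquality A) (g : B → List A) (a : A) where

  open DecMembership _≟_ using (_∈?_)

  length-filter-∈-∉ : (xs : List B) → a ∉ concat (map g xs) → length (filter (λ x → a ∈? g x) xs) ≡ 0
  length-filter-∈-∉ []       _  = refl
  length-filter-∈-∉ (x ∷ xs) a∉ with a ∈? g x
  ... | yes a∈ = ⊥-elim (a∉ (∈-++⁺ˡ a∈))
  ... | no _   = length-filter-∈-∉ xs (a∉ ∘ ∈-++⁺ʳ (g x))

  length-filter-∈-unique : (xs : List B) → Unique (concat (map g xs)) → length (filter (λ x → a ∈? g x) xs) ≤ 1
  length-filter-∈-unique []       _ = z≤n
  length-filter-∈-unique (x ∷ xs) u with a ∈? g x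
  ... | yes a∈ = s≤s (≤-reflexive (length-filter-∈-∉ xs (Unique-++⇒∉ (g x) u a∈)))
  ... | no _   = length-filter-∈-unique xs (Unique-++⁻ʳ (g x) u)

lists≤ : List A → ℕ → List (List A)
lists≤ S zero    = [] ∷ []
lists≤ S (suc n) = [] ∷ concatMap (λ x → map (x ∷_) (lists≤ S n)) S

∈-lists≤ : {S xs : List A} {n : ℕ} → All (_∈ S) xs → length xs ≤ n → xs ∈ lists≤ S n
∈-lists≤ {n = zero}  []         _         = here refl
∈-lists≤ {n = suc n} []         _         = here refl
∈-lists≤ {n = suc n} (x∈S ∷ xs⊆S) (s≤s len) = there (∈-concatMap⁺ _ (Any.map (λ { refl → ∈-map⁺ _ (∈-lists≤ xs⊆S len) }) x∈S))

minimum-of-dominating : {Q : A → Set} (f : A → ℕ) (xs : List A) →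
                        (∀ {a} → Q a → Σ A λ x → x ∈ xs × f x ≤ f a) →
                        ∀ {a₀} → Q a₀ → Σ A λ x → x ∈ xs × (∀ {a} → Q a → f x ≤ f a)
minimum-of-dominating {Q = Q} f xs dominate q₀ with dominate q₀
... | x₀ , x₀∈ , _ = argmin f x₀ xs , argmin-all f x₀∈ (All.tabulate (λ x∈ → x∈)) , below
  where
    below : ∀ {a} → Q a → f (argmin f x₀ xs) ≤ f a
    below q with dominate q
    ... | y , y∈ , fy≤fa = ≤-trans (All.lookup (f[argmin]≤f[xs] x₀ xs) y∈) fy≤fa

at : List A → ℕ → A → A
at []       _       d = d
at (x ∷ _)  zero    _ = x
at (_ ∷ xs) (suc i) d = at xs i d

last-∷ʳ : (xs : List A) (x : A) → last (xs ∷ʳ x) ≡ just x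
last-∷ʳ []           x = refl
last-∷ʳ (_ ∷ [])     x = refl
last-∷ʳ (_ ∷ y ∷ xs) x = last-∷ʳ (y ∷ xs) x

head≡⇒∷ : (xs : List A) {x : A} → head xs ≡ just x → x ∷ drop 1 xs ≡ xs
head≡⇒∷ (x ∷ xs) refl = refl

last≡⇒∈ : (xs : List A) {x : A} → last xs ≡ just x → x ∈ xs
last≡⇒∈ (x ∷ [])     refl = here refl
last≡⇒∈ (_ ∷ y ∷ xs) eq   = there (last≡⇒∈ (y ∷ xs) eq)

-- The entries at positions a to b, both included.
slice : List A → ℕ → ℕ → List A
slice []       _       _       = []
slice (x ∷ _)  zero    zero    = x ∷ []
slice (x ∷ xs) zero    (suc b) = x ∷ slice xs zero b
slice (_ ∷ _)  (suc _) zero    = []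
slice (_ ∷ xs) (suc a) (suc b) = slice xs a b

slice-head : (xs : List A) {a b : ℕ} (d : A) → a ≤ b → a < length xs → head (slice xs a b) ≡ just (at xs a d)
slice-head (x ∷ xs) {zero} {zero}  d _ _ = refl
slice-head (x ∷ xs) {zero} {suc b} d _ _ = refl
slice-head (x ∷ xs) {suc a} {suc b} d (s≤s a≤b) (s≤s a<n) = slice-head xs d a≤b a<n

slice-last : (xs : List A) {a b : ℕ} (d : A) → a ≤ b → b < length xs → last (slice xs a b) ≡ just (at xs b d)
slice-last (x ∷ xs)     {zero}  {zero}        d _ _         = refl
slice-last (x ∷ [])     {zero}  {suc b}       d _ (s≤s ())
slice-last (x ∷ y ∷ xs) {zero}  {suc zero}    d _ _         = refl
slice-last (x ∷ y ∷ xs) {zero}  {suc (suc b)} d _ (s≤s b<n) = slice-last (y ∷ xs) d z≤n b<n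
slice-last (x ∷ xs)     {suc a} {suc b}       d (s≤s a≤b) (s≤s b<n) = slice-last xs d a≤b b<n

slice-linked : (xs : List A) (a b : ℕ) → Linked R xs → Linked R (slice xs a b)
slice-linked []           _       _             _        = []
slice-linked (x ∷ xs)     zero    zero          _        = [-]
slice-linked (x ∷ [])     zero    (suc b)       _        = [-]
slice-linked (x ∷ y ∷ xs) zero    (suc zero)    (r ∷ _)  = r ∷ [-]
slice-linked (x ∷ y ∷ xs) zero    (suc (suc b)) (r ∷ l)  = r ∷ slice-linked (y ∷ xs) zero (suc b) l
slice-linked (x ∷ xs)     (suc a) zero          _        = []
slice-linked (x ∷ xs)     (suc a) (suc b)       l        = slice-linked xs a b (Linked.tail l)

slice⊆ : (xs : List A) (a b : ℕ) → slice xs a b ⊆ xs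
slice⊆ (x ∷ xs) zero    zero    (here refl) = here refl
slice⊆ (x ∷ xs) zero    (suc b) (here refl) = here refl
slice⊆ (x ∷ xs) zero    (suc b) (there z∈)  = there (slice⊆ xs zero b z∈)
slice⊆ (x ∷ xs) (suc a) (suc b) z∈          = there (slice⊆ xs a b z∈)

slice-unique : (xs : List A) (a b : ℕ) → Unique xs → Unique (slice xs a b)
slice-unique []       _       _       _          = []
slice-unique (x ∷ xs) zero    zero    _          = [] ∷ []
slice-unique (x ∷ xs) zero    (suc b) (x∉ ∷ u)   = anti-mono (slice⊆ xs zero b) x∉ ∷ slice-unique xs zero b u
slice-unique (x ∷ xs) (suc a) zero    _          = []
slice-unique (x ∷ xs) (suc a) (suc b) (_ ∷ u)    = slice-unique xs a b u

slice-++ : (xs : List A) {a b c : ℕ} → a ≤ b → b ≤ c → slice xs a b ++ drop 1 (slice xs b c) ≡ slice xs a c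
slice-++ []       _ _ = refl
slice-++ (x ∷ xs) {zero}  {zero}  {zero}  _ _ = refl
slice-++ (x ∷ xs) {zero}  {zero}  {suc c} _ _ = refl
slice-++ (x ∷ xs) {zero}  {suc b} {suc c} _ (s≤s b≤c) = cong (x ∷_) (slice-++ xs z≤n b≤c)
slice-++ (x ∷ xs) {suc a} {suc b} {suc c} (s≤s a≤b) (s≤s b≤c) = slice-++ xs a≤b b≤c

slice-single : (xs : List A) {a : ℕ} (d : A) → a < length xs → slice xs a a ≡ at xs a d ∷ []
slice-single (x ∷ xs) {zero}  d _ = refl
slice-single (x ∷ xs) {suc a} d (s≤s a<n) = slice-single xs d a<n

at-linked : (xs : List A) {k : ℕ} (d : A) → Linked R xs → suc k < length xs → R (at xs k d) (at xs (suc k) d)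
at-linked (x ∷ [])     {k}     d [-]     (s≤s ())
at-linked (x ∷ y ∷ xs) {zero}  d (r ∷ _) _         = r
at-linked (x ∷ y ∷ xs) {suc k} d (_ ∷ l) (s≤s k<n) = at-linked (y ∷ xs) d l k<n

at-all : {P : A → Set} (xs : List A) {k : ℕ} (d : A) → All P xs → k < length xs → P (at xs k d)
at-all (x ∷ xs) {zero}  d (px ∷ _)  _         = px
at-all (x ∷ xs) {suc k} d (_ ∷ pxs) (s≤s k<n) = at-all xs d pxs k<n

tabulate-at : {n : ℕ} (xs : List A) (d : A) → length xs ≡ n → tabulate {n = n} (λ k → at xs (toℕ k) d) ≡ xs
tabulate-at []       d refl = refl
tabulate-at (x ∷ xs) d refl = cong (x ∷_) (tabulate-at xs d refl)

at-lookup : (xs : List A) (i : Fin (length xs)) (d : A) → at xs (toℕ i) d ≡ lookup xs i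
at-lookup (x ∷ xs) fzero    d = refl
at-lookup (x ∷ xs) (fsuc i) d = at-lookup xs i d

-- The cycle

toℕ-next : (x : Fin (suc m)) → toℕ (next m x) ≡ suc (toℕ x) ⊎ (toℕ x ≡ m × toℕ (next m x) ≡ 0)
toℕ-next {m} x with m≤n⇒m<n∨m≡n (toℕ≤pred[n] x)
... | inj₁ x<m = inj₁ (trans (toℕ-fromℕ< _) (m<n⇒m%n≡m (s≤s x<m)))
... | inj₂ x≡m = inj₂ (x≡m , trans (toℕ-fromℕ< _) (subst (λ k → suc k % suc m ≡ 0) (sym x≡m) (n%n≡0 (suc m))))

next-injective : next m x ≡ next m y → x ≡ y
next-injective {x = x} {y = y} eq with toℕ-next x | toℕ-next y
... | inj₁ nx | inj₁ ny = toℕ-injective (suc-injective (trans (sym nx) (trans (cong toℕ eq) ny)))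
... | inj₁ nx | inj₂ (_ , ny) with () ← trans (sym nx) (trans (cong toℕ eq) ny)
... | inj₂ (_ , nx) | inj₁ ny with () ← trans (sym ny) (trans (cong toℕ (sym eq)) nx)
... | inj₂ (x≡m , _) | inj₂ (y≡m , _) = toℕ-injective (trans x≡m (sym y≡m))

next-not-involutive : 2 ≤ m → next m x ≡ y → next m y ≢ x
next-not-involutive {m} {x} 2≤m refl yx with toℕ-next x | toℕ-next (next m x) | cong toℕ yx
... | inj₁ nx | inj₁ ny | back = m≢1+n+m (toℕ x) {1} (trans (sym back) (trans ny (cong suc nx)))
... | inj₁ nx | inj₂ (y≡m , ny) | back = 1≢m (trans (cong suc (trans (sym ny) back)) (trans (sym nx) y≡m))
  where 1≢m = <⇒≢ 2≤m
... | inj₂ (x≡m , nx) | inj₁ ny | back = 1≢m (trans (cong suc (sym nx)) (trans (sym ny) (trans back x≡m)))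
  where 1≢m = <⇒≢ 2≤m
... | inj₂ (x≡m , nx) | inj₂ (y≡m , _) | _ = <⇒≢ (<-trans z<s 2≤m) (trans (sym nx) y≡m)

Adj-sym : Adj m x y → Adj m y x
Adj-sym (inj₁ e) = inj₂ e
Adj-sym (inj₂ e) = inj₁ e

Adj? : (x y : Fin (suc m)) → Dec (Adj m x y)
Adj? {m} x y = (next m x ≟F y) ⊎-dec (next m y ≟F x)

-- Pigeonhole: two of the three adjacencies have the same form, next y ≡ _ or next _ ≡ y, and next is injective.
at-most-two-neighbours : Adj m y a → Adj m y b → Adj m y c → a ≢ b → a ≢ c → b ≢ c → ⊥
at-most-two-neighbours (inj₁ ya) (inj₁ yb) _ a≢b _ _ = a≢b (trans (sym ya) yb)
at-most-two-neighbours (inj₂ ay) (inj₂ by) _ a≢b _ _ = a≢b (next-injective (trans ay (sym by)))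
at-most-two-neighbours (inj₁ ya) _ (inj₁ yc) _ a≢c _ = a≢c (trans (sym ya) yc)
at-most-two-neighbours (inj₂ ay) _ (inj₂ cy) _ a≢c _ = a≢c (next-injective (trans ay (sym cy)))
at-most-two-neighbours _ (inj₁ yb) (inj₁ yc) _ _ b≢c = b≢c (trans (sym yb) yc)
at-most-two-neighbours _ (inj₂ by) (inj₂ cy) _ _ b≢c = b≢c (next-injective (trans by (sym cy)))

edgeOf-cases : (x y : Fin (suc m)) → (next m x ≡ y × edgeOf m x y ≡ x) ⊎ (next m x ≢ y × edgeOf m x y ≡ y)
edgeOf-cases {m} x y with next m x ≟F y
... | yes xy = inj₁ (xy , refl)
... | no ¬xy = inj₂ (¬xy , refl)

edgeOf-comm : 2 ≤ m → Adj m x y → edgeOf m x y ≡ edgeOf m y x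
edgeOf-comm {m} {x} {y} 2≤m adj with next m x ≟F y | next m y ≟F x | adj
... | yes xy | yes yx | _ = ⊥-elim (next-not-involutive 2≤m xy yx)
... | yes _  | no _   | _ = refl
... | no _   | yes _  | _ = refl
... | no ¬xy | no _   | inj₁ xy = ⊥-elim (¬xy xy)
... | no _   | no ¬yx | inj₂ yx = ⊥-elim (¬yx yx)

Adj-¬next : Adj m x y → next m x ≢ y → next m y ≡ x
Adj-¬next (inj₁ xy) ¬xy = ⊥-elim (¬xy xy)
Adj-¬next (inj₂ yx) _   = yx

pathEdges-++ : (xs ys : List (Fin (suc m))) → last xs ≡ just z →
               pathEdges m (xs ++ ys) ≡ pathEdges m xs ++ pathEdges m (z ∷ ys)
pathEdges-++ (x ∷ [])     ys refl = refl
pathEdges-++ (x ∷ y ∷ xs) ys eq   = cong (_ ∷_) (pathEdges-++ (y ∷ xs) ys eq)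

pathEdges⊆ : (xs : List (Fin (suc m))) → pathEdges m xs ⊆ xs
pathEdges⊆ (x ∷ y ∷ xs) (here refl) with edgeOf-cases x y
... | inj₁ (_ , e≡x) = here e≡x
... | inj₂ (_ , e≡y) = there (here e≡y)
pathEdges⊆ (x ∷ y ∷ xs) (there e∈) = there (pathEdges⊆ (y ∷ xs) e∈)

edgeOf∉pathEdges : (xs : List (Fin (suc m))) → Adj m x y → x ∉ y ∷ xs → y ∉ xs →
                   edgeOf m x y ∉ pathEdges m (y ∷ xs)
-- If the first edge is labelled y then next y ≡ x, so a later edge {y, z} is labelled z, as z ≢ x.
edgeOf∉pathEdges {x = x} {y = y} xs adj x∉ y∉ e∈ with edgeOf-cases x y
... | inj₁ (_ , e≡x) = x∉ (pathEdges⊆ (y ∷ xs) (subst (_∈ _) e≡x e∈))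
... | inj₂ (¬xy , e≡y) = y∉ (y-edge xs x∉ (subst (_∈ _) e≡y e∈))
  where
    yx = Adj-¬next adj ¬xy
    y-edge : (zs : List (Fin (suc _))) → x ∉ y ∷ zs → y ∈ pathEdges _ (y ∷ zs) → y ∈ zs
    y-edge (z ∷ zs) x∉ (here y≡e) with edgeOf-cases y z
    ... | inj₁ (yz , _) = ⊥-elim (x∉ (there (here (trans (sym yx) yz))))
    ... | inj₂ (_ , e≡z) = here (trans y≡e e≡z)
    y-edge (z ∷ zs) _ (there y∈) = pathEdges⊆ (z ∷ zs) y∈

pathEdges-unique : Linked (Adj m) xs → Unique xs → Unique (pathEdges m xs)
pathEdges-unique {xs = []}         _         _          = []
pathEdges-unique {xs = x ∷ []}     _         _          = []
pathEdges-unique {xs = x ∷ y ∷ xs} (adj ∷ l) (x∉ ∷ u) =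
  ¬Any⇒All¬ _ (edgeOf∉pathEdges xs adj (All¬⇒¬Any x∉) (Unique[x∷xs]⇒x∉xs u)) ∷ pathEdges-unique l u

pathEdges-slice⊆ : (xs : List (Fin (suc m))) (a b : ℕ) → pathEdges m (slice xs a b) ⊆ pathEdges m xs
pathEdges-slice⊆ (x ∷ y ∷ xs) zero    (suc zero)    (here refl) = here refl
pathEdges-slice⊆ (x ∷ y ∷ xs) zero    (suc (suc b)) (here refl) = here refl
pathEdges-slice⊆ (x ∷ y ∷ xs) zero    (suc (suc b)) (there e∈)  = there (pathEdges-slice⊆ (y ∷ xs) zero (suc b) e∈)
pathEdges-slice⊆ (x ∷ y ∷ xs) (suc a) (suc b)       e∈          = there (pathEdges-slice⊆ (y ∷ xs) a b e∈)

-- Collecting a walk into an elementary path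

adjacent-outside⇒endpoint : Linked (Adj m) P → Unique P → y ∈ P → Adj m y x → x ∉ P →
                            (∃ λ ys → P ≡ y ∷ ys) ⊎ (∃ λ xs → P ≡ xs ∷ʳ y)
adjacent-outside⇒endpoint _ _ (here refl) _ _ = inj₁ (_ , refl)
adjacent-outside⇒endpoint {P = z ∷ P} lP (z∉ ∷ uP) (there y∈) yx x∉
  with adjacent-outside⇒endpoint (Linked.tail lP) uP y∈ yx (x∉ ∘ there)
... | inj₂ (xs , refl)     = inj₂ (z ∷ xs , refl)
... | inj₁ ([] , refl)     = inj₂ (z ∷ [] , refl)
... | inj₁ (b ∷ ys , refl) with lP | z∉
... | zy ∷ yb ∷ _ | _ ∷ z≢b ∷ _ = ⊥-elim (at-most-two-neighbours (Adj-sym zy) yb yx z≢b z≢x b≢x)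
  where
    z≢x = λ z≡x → x∉ (here (sym z≡x))
    b≢x = λ b≡x → x∉ (there (there (here (sym b≡x))))

record ElementaryCover (m : ℕ) (W P : List (Fin (suc m))) : Set where
  field
    linked : Linked (Adj m) P
    unique : Unique P
    covers : W ⊆ P
    edges⊆ : pathEdges m P ⊆ pathEdges m W
open ElementaryCover

absorb : x ∈ P → ElementaryCover m (y ∷ W) P → ElementaryCover m (x ∷ y ∷ W) P
absorb x∈ C = record
  { linked = linked C
  ; unique = unique C
  ; covers = λ { (here refl) → x∈ ; (there z∈) → covers C z∈ }
  ; edges⊆ = there ∘ edges⊆ C
  }

prepend : Adj m x y → x ∉ y ∷ ys → ElementaryCover m (y ∷ W) (y ∷ ys) → ElementaryCover m (x ∷ y ∷ W) (x ∷ y ∷ ys)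
prepend xy x∉ C = record
  { linked = xy ∷ linked C
  ; unique = ¬Any⇒All¬ _ x∉ ∷ unique C
  ; covers = λ { (here refl) → here refl ; (there z∈) → there (covers C z∈) }
  ; edges⊆ = λ { (here refl) → here refl ; (there e∈) → there (edges⊆ C e∈) }
  }

append : 2 ≤ m → Adj m x y → x ∉ xs ∷ʳ y →
         ElementaryCover m (y ∷ W) (xs ∷ʳ y) → ElementaryCover m (x ∷ y ∷ W) (xs ∷ʳ y ∷ʳ x)
append {m} {x} {y} {xs = xs} {W = W} 2≤m xy x∉ C = record
  { linked = Linkedₚ.++⁺ (linked C) y-x [-]
  ; unique = Uniqueₚ.++⁺ (unique C) ([] ∷ []) λ { (x∈ , here refl) → x∉ x∈ }
  ; covers = λ { (here refl) → ∈-++⁺ʳ (xs ∷ʳ y) (here refl) ; (there z∈) → ∈-++⁺ˡ (covers C z∈) }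
  ; edges⊆ = edges⊆′ ∘ subst (_ ∈_) (pathEdges-++ (xs ∷ʳ y) (x ∷ []) (last-∷ʳ xs y))
  }
  where
    y-x : Connected (Adj m) (last (xs ∷ʳ y)) (just x)
    y-x = subst (λ l → Connected (Adj m) l (just x)) (sym (last-∷ʳ xs y)) (just (Adj-sym xy))

    edges⊆′ : pathEdges m (xs ∷ʳ y) ∷ʳ edgeOf m y x ⊆ pathEdges m (x ∷ y ∷ W)
    edges⊆′ e∈ with ∈-++⁻ (pathEdges m (xs ∷ʳ y)) e∈
    ... | inj₁ e∈P         = there (edges⊆ C e∈P)
    ... | inj₂ (here refl) = here (edgeOf-comm 2≤m (Adj-sym xy))

elementaryCover : 2 ≤ m → Linked (Adj m) W → Σ (List (Fin (suc m))) (ElementaryCover m W)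
elementaryCover _ [] = [] , record { linked = [] ; unique = [] ; covers = λ () ; edges⊆ = λ () }
elementaryCover _ [-] = _ , record { linked = [-] ; unique = [] ∷ [] ; covers = λ z∈ → z∈ ; edges⊆ = λ () }
elementaryCover {W = x ∷ _} 2≤m (xy ∷ l) with elementaryCover 2≤m l
... | P , C with DecMembership._∈?_ _≟F_ x P
... | yes x∈ = P , absorb x∈ C
... | no x∉ with adjacent-outside⇒endpoint (linked C) (unique C) (covers C (here refl)) (Adj-sym xy) x∉
... | inj₁ (_ , refl) = _ , prepend xy x∉ C
... | inj₂ (_ , refl) = _ , append 2≤m xy x∉ C

trail : (Fin (suc p) → A) → (Fin p → List A) → List A
trail v P = v fzero ∷ concat (tabulate (drop 1 ∘ P))

record IsChain (m : ℕ) (v : Fin (suc p) → Fin (suc m)) (P : Fin p → List (Fin (suc m))) : Set where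
  constructor chain
  field isPath : ∀ j → IsPath m (v (inject₁ j)) (v (fsuc j)) (P j)
open IsChain

IsChain-tail : {v : Fin (suc (suc p)) → Fin (suc m)} {P : Fin (suc p) → List (Fin (suc m))} →
               IsChain m v P → IsChain m (v ∘ fsuc) (P ∘ fsuc)
IsChain-tail c = chain (isPath c ∘ fsuc)

trail-suc : {v : Fin (suc (suc p)) → Fin (suc m)} {P : Fin (suc p) → List (Fin (suc m))} →
            IsChain m v P → trail v P ≡ P fzero ++ drop 1 (trail (v ∘ fsuc) (P ∘ fsuc))
trail-suc {v = v} {P} c = cong (_++ drop 1 (trail (v ∘ fsuc) (P ∘ fsuc))) (head≡⇒∷ (P fzero) (IsPath.startsAt (isPath c fzero)))

trail-linked : {v : Fin (suc p) → Fin (suc m)} {P : Fin p → List (Fin (suc m))} →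
               IsChain m v P → Linked (Adj m) (trail v P)
trail-linked {zero}  c = [-]
trail-linked {suc p} {m} {v} {P} c = subst (Linked (Adj m)) (sym (trail-suc c))
  (Linkedₚ.++⁺ (IsPath.linked (isPath c fzero))
               (subst (λ l → Connected (Adj m) l (head rest)) (sym (IsPath.endsAt (isPath c fzero))) (Linked.head′ l))
               (Linked.tail l))
  where
    rest = drop 1 (trail (v ∘ fsuc) (P ∘ fsuc))
    l    = trail-linked (IsChain-tail c)

∈-trail : {v : Fin (suc p) → Fin (suc m)} {P : Fin p → List (Fin (suc m))} →
          IsChain m v P → ∀ k → v k ∈ trail v P
∈-trail c fzero = here refl
∈-trail {suc p} {P = P} c (fsuc k) with ∈-trail (IsChain-tail c) k
... | here eq   = subst (_ ∈_) (sym (trail-suc c)) (∈-++⁺ˡ (subst (_∈ P fzero) (sym eq) (last≡⇒∈ _ (IsPath.endsAt (isPath c fzero)))))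
... | there v∈  = subst (_ ∈_) (sym (trail-suc c)) (∈-++⁺ʳ _ v∈)

pathEdges-trail : {v : Fin (suc p) → Fin (suc m)} {P : Fin p → List (Fin (suc m))} →
                  IsChain m v P → pathEdges m (trail v P) ≡ concat (tabulate (pathEdges m ∘ P))
pathEdges-trail {zero}  c = refl
pathEdges-trail {suc p} {m} {v} {P} c = begin
  pathEdges m (trail v P)                                  ≡⟨ cong (pathEdges m) (trail-suc c) ⟩
  pathEdges m (P fzero ++ drop 1 trail′)                   ≡⟨ pathEdges-++ (P fzero) _ (IsPath.endsAt (isPath c fzero)) ⟩
  pathEdges m (P fzero) ++ pathEdges m trail′              ≡⟨ cong (pathEdges m (P fzero) ++_) (pathEdges-trail (IsChain-tail c)) ⟩
  pathEdges m (P fzero) ++ concat (tabulate (pathEdges m ∘ P ∘ fsuc)) ∎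
  where
    open ≡-Reasoning
    trail′ = trail (v ∘ fsuc) (P ∘ fsuc)

module _ (M : Mapping p m) where

  isChain : IsChain m (mV M) (mE M)
  isChain = chain (mEpath M)

  walk≡trail : walk M ≡ trail (mV M) (mE M)
  walk≡trail = cong (λ ps → mV M _ ∷ concat ps) (map-tabulate id (drop 1 ∘ mE M))

  walk-linked : Linked (Adj m) (walk M)
  walk-linked = subst (Linked (Adj m)) (sym walk≡trail) (trail-linked isChain)

  mV∈walk : ∀ k → mV M k ∈ walk M
  mV∈walk k = subst (mV M k ∈_) (sym walk≡trail) (∈-trail isChain k)

  pathEdges-walk : pathEdges m (walk M) ≡ concat (map (pathEdges m ∘ mE M) (allFin p))
  pathEdges-walk = begin
    pathEdges m (walk M)                           ≡⟨ cong (pathEdges m) walk≡trail ⟩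
    pathEdges m (trail (mV M) (mE M))              ≡⟨ pathEdges-trail isChain ⟩
    concat (tabulate (pathEdges m ∘ mE M))         ≡⟨ cong concat (map-tabulate id (pathEdges m ∘ mE M)) ⟨
    concat (map (pathEdges m ∘ mE M) (allFin p))   ∎
    where open ≡-Reasoning

  images : List (Fin (suc m))
  images = map (mV M) (allFin (suc p))

  nodeLoad-images : ∀ u → nodeLoad M u ≡ length (filter (_≟F u) images)
  nodeLoad-images u = sym (length-filter-map (_≟F u) (mV M) (allFin (suc p)))

  nodeCost-images : (wN : Fin (suc m) → ℕ) → sum (map (wN ∘ mV M) (allFin (suc p))) ≡ sum (map wN images)
  nodeCost-images wN = cong sum (map-∘ (allFin (suc p)))

  edgeCost-walk : (wE : Fin (suc m) → ℕ) →
                  sum (map (sum ∘ map wE ∘ pathEdges m ∘ mE M) (allFin p)) ≡ sum (map wE (pathEdges m (walk M)))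
  edgeCost-walk wE = begin
    sum (map (sum ∘ map wE ∘ pathEdges m ∘ mE M) (allFin p))       ≡⟨ cong sum (map-∘ (allFin p)) ⟩
    sum (map (sum ∘ map wE) (map (pathEdges m ∘ mE M) (allFin p))) ≡⟨ sum-map-concat wE (map (pathEdges m ∘ mE M) (allFin p)) ⟨
    sum (map wE (concat (map (pathEdges m ∘ mE M) (allFin p))))    ≡⟨ cong (sum ∘ map wE) pathEdges-walk ⟨
    sum (map wE (pathEdges m (walk M)))                            ∎
    where open ≡-Reasoning

  edgeLoad≤1 : Unique (pathEdges m (walk M)) → ∀ e → edgeLoad M e ≤ 1
  edgeLoad≤1 u e = length-filter-∈-unique _≟F_ (pathEdges m ∘ mE M) e (allFin p) (subst Unique pathEdges-walk u)

cost≡ : (wN wE : Fin (suc m) → ℕ) (M : Mapping p m) →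
        cost wN wE M ≡ sum (map wN (images M)) + sum (map wE (pathEdges m (walk M)))
cost≡ wN wE M = cong₂ _+_ (nodeCost-images M wN) (edgeCost-walk M wE)

module _ (M M′ : Mapping p m) (images↭ : images M ↭ images M′) where

  nodeLoad-↭ : ∀ u → nodeLoad M u ≡ nodeLoad M′ u
  nodeLoad-↭ u = begin
    nodeLoad M u                          ≡⟨ nodeLoad-images M u ⟩
    length (filter (_≟F u) (images M))    ≡⟨ ↭-length (filter-↭ (_≟F u) images↭) ⟩
    length (filter (_≟F u) (images M′))   ≡⟨ nodeLoad-images M′ u ⟨
    nodeLoad M′ u                         ∎
    where open ≡-Reasoning

  cost-↭-≤ : (wN wE : Fin (suc m) → ℕ) →
             sum (map wE (pathEdges m (walk M))) ≤ sum (map wE (pathEdges m (walk M′))) →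
             cost wN wE M ≤ cost wN wE M′
  cost-↭-≤ wN wE edges≤ = begin
    cost wN wE M                                                   ≡⟨ cost≡ wN wE M ⟩
    sum (map wN (images M)) + sum (map wE (pathEdges m (walk M)))  ≤⟨ +-mono-≤ (≤-reflexive (sum-↭ (map⁺ wN images↭))) edges≤ ⟩
    sum (map wN (images M′)) + sum (map wE (pathEdges m (walk M′))) ≡⟨ cost≡ wN wE M′ ⟨
    cost wN wE M′                                                  ∎
    where open ≤-Reasoning

-- Mappings along a route

≤-steps : (s : ℕ → ℕ) → (∀ k → k < p → s k ≤ s (suc k)) → s 0 ≤ s p
≤-steps {zero}  s step = ≤-refl
≤-steps {suc p} s step = ≤-trans (step 0 (s≤s z≤n)) (≤-steps (s ∘ suc) (λ k k<p → step (suc k) (s≤s k<p)))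

stopsOn : List A → A → (ℕ → ℕ) → Fin (suc p) → A
stopsOn xs d s k = at xs (s (toℕ k)) d

legsOn : List A → (ℕ → ℕ) → Fin p → List A
legsOn xs s j = slice xs (s (toℕ j)) (s (suc (toℕ j)))

trail-slices : (xs : List A) (d : A) (s : ℕ → ℕ) → (∀ k → k < p → s k ≤ s (suc k)) → (∀ k → k ≤ p → s k < length xs) →
               trail {p = p} (stopsOn xs d s) (legsOn xs s) ≡ slice xs (s 0) (s p)
trail-slices {p = zero} xs d s _ bounded = sym (slice-single xs d (bounded 0 z≤n))
trail-slices {p = suc p} xs d s step bounded = begin
  at xs (s 0) d ∷ drop 1 (slice xs (s 0) (s 1)) ++ drop 1 (trail {p = p} (stopsOn xs d (s ∘ suc)) (legsOn xs (s ∘ suc)))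
    ≡⟨ cong₂ (λ l r → l ++ drop 1 r) (head≡⇒∷ _ (slice-head xs d (step 0 (s≤s z≤n)) (bounded 0 z≤n)))
                                      (trail-slices xs d (s ∘ suc) step′ (λ k k≤p → bounded (suc k) (s≤s k≤p))) ⟩
  slice xs (s 0) (s 1) ++ drop 1 (slice xs (s 1) (s (suc p)))
    ≡⟨ slice-++ xs (step 0 (s≤s z≤n)) (≤-steps (s ∘ suc) step′) ⟩
  slice xs (s 0) (s (suc p)) ∎
  where
    open ≡-Reasoning
    step′ : ∀ k → k < p → s (suc k) ≤ s (suc (suc k))
    step′ k k<p = step (suc k) (s≤s k<p)

record Layout (m p : ℕ) (route : List (Fin (suc m))) (stops : List ℕ) : Set where
  field
    route-linked  : Linked (Adj m) route
    route-unique  : Unique route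
    stops-sorted  : Linked _≤_ stops
    stops-bounded : All (_< length route) stops
    stops-length  : length stops ≡ suc p

module _ {route : List (Fin (suc m))} {stops : List ℕ} (L : Layout m p route stops) where

  open Layout L

  private
    s : ℕ → ℕ
    s k = at stops k 0

    s-step : ∀ k → k < p → s k ≤ s (suc k)
    s-step k k<p = at-linked stops 0 stops-sorted (subst (suc k <_) (sym stops-length) (s≤s k<p))

    s-bounded : ∀ k → k ≤ p → s k < length route
    s-bounded k k≤p = at-all stops 0 stops-bounded (subst (k <_) (sym stops-length) (s≤s k≤p))

    leg-isPath : ∀ j → IsPath m (stopsOn route fzero s (inject₁ j)) (stopsOn route fzero s (fsuc j)) (legsOn route s j)
    leg-isPath j rewrite toℕ-inject₁ j = record
      { startsAt = slice-head route fzero (s-step (toℕ j) (toℕ<n j)) (s-bounded (toℕ j) (<⇒≤ (toℕ<n j)))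
      ; endsAt   = slice-last route fzero (s-step (toℕ j) (toℕ<n j)) (s-bounded (suc (toℕ j)) (toℕ<n j))
      ; linked   = slice-linked route _ _ route-linked
      ; loopFree = slice-unique route _ _ route-unique
      }

  layoutMapping : Mapping p m
  layoutMapping = record { mV = stopsOn route fzero s ; mE = legsOn route s ; mEpath = leg-isPath }

  walk-layoutMapping : walk layoutMapping ≡ slice route (s 0) (s p)
  walk-layoutMapping = trans (walk≡trail layoutMapping) (trail-slices route fzero s s-step s-bounded)

  layoutMapping-elementary : ElementaryPathMapping layoutMapping
  layoutMapping-elementary = subst Unique (sym walk-layoutMapping) (slice-unique route _ _ route-unique)

  layoutMapping-pathEdges-unique : Unique (pathEdges m (walk layoutMapping))
  layoutMapping-pathEdges-unique = subst (Unique ∘ pathEdges m) (sym walk-layoutMapping)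
    (pathEdges-unique (slice-linked route _ _ route-linked) (slice-unique route _ _ route-unique))

  layoutMapping-pathEdges⊆ : pathEdges m (walk layoutMapping) ⊆ pathEdges m route
  layoutMapping-pathEdges⊆ = pathEdges-slice⊆ route _ _ ∘ subst (_ ∈_) (cong (pathEdges m) walk-layoutMapping)

  images-layoutMapping : images layoutMapping ≡ map (λ i → at route i fzero) stops
  images-layoutMapping = begin
    map (stopsOn route fzero s) (allFin (suc p))   ≡⟨ map-tabulate id (stopsOn route fzero s) ⟩
    tabulate (at′ ∘ λ k → at stops (toℕ k) 0)      ≡⟨ map-tabulate (λ k → at stops (toℕ k) 0) at′ ⟨
    map at′ (tabulate λ k → at stops (toℕ k) 0)    ≡⟨ cong (map at′) (tabulate-at stops 0 stops-length) ⟩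
    map at′ stops                                  ∎
    where
      open ≡-Reasoning
      at′ = λ i → at route i fzero

module Compression {p m : ℕ} (2≤m : 2 ≤ m) (M′ : Mapping p m) where

  private
    cover : Σ (List (Fin (suc m))) (ElementaryCover m (walk M′))
    cover = elementaryCover 2≤m (walk-linked M′)

  route : List (Fin (suc m))
  route = proj₁ cover

  private
    C = proj₂ cover

  mV∈route : ∀ k → mV M′ k ∈ route
  mV∈route k = covers C (mV∈walk M′ k)

  position : Fin (suc p) → ℕ
  position k = toℕ (index (mV∈route k))

  positions : List ℕ
  positions = map position (allFin (suc p))

  stops : List ℕ
  stops = sort positions

  at-position : ∀ k → at route (position k) fzero ≡ mV M′ k
  at-position k = trans (at-lookup route _ fzero) (sym (lookup-index (mV∈route k)))

  layout : Layout m p route stops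
  layout = record
    { route-linked  = linked C
    ; route-unique  = unique C
    ; stops-sorted  = sort-↗ positions
    ; stops-bounded = All-resp-↭ (↭-sym (sort-↭ positions)) (All-map⁺ (All.universal (λ k → toℕ<n _) (allFin (suc p))))
    ; stops-length  = trans (↭-length (sort-↭ positions)) (trans (length-map position (allFin (suc p))) (length-tabulate {n = suc p} (λ k → k)))
    }

  module _ (L : Layout m p route stops) where

    images↭ : images (layoutMapping L) ↭ images M′
    images↭ = subst (_↭ images M′) (sym (images-layoutMapping L)) (begin
      map (λ i → at route i fzero) stops        ↭⟨ map⁺ _ (sort-↭ positions) ⟩
      map (λ i → at route i fzero) positions    ≡⟨ map-∘ (allFin (suc p)) ⟨
      map (λ k → at route (position k) fzero) (allFin (suc p)) ≡⟨ map-cong at-position (allFin (suc p)) ⟩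
      images M′ ∎)
      where open PermutationReasoning

    pathEdges-≤ : (wE : Fin (suc m) → ℕ) → sum (map wE (pathEdges m (walk (layoutMapping L)))) ≤ sum (map wE (pathEdges m (walk M′)))
    pathEdges-≤ wE = sum-map-mono-⊆ wE (layoutMapping-pathEdges-unique L) (edges⊆ C ∘ layoutMapping-pathEdges⊆ L)

    feasible : {cN cE : Fin (suc m) → ℕ} → (∀ e → 1 ≤ cE e) → Feasible cN cE M′ → Feasible cN cE (layoutMapping L)
    feasible {cN} {cE} cE≥1 (nodes-ok , _) =
        (λ u → subst (_≤ cN u) (sym (nodeLoad-↭ (layoutMapping L) M′ images↭ u)) (nodes-ok u))
      , (λ e → ≤-trans (edgeLoad≤1 (layoutMapping L) (layoutMapping-pathEdges-unique L) e) (cE≥1 e))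

    cost-≤ : (wN wE : Fin (suc m) → ℕ) → cost wN wE (layoutMapping L) ≤ cost wN wE M′
    cost-≤ wN wE = cost-↭-≤ (layoutMapping L) M′ images↭ wN wE (pathEdges-≤ wE)

-- Finitely many candidates

layout? : (route : List (Fin (suc m))) (stops : List ℕ) → Dec (Layout m p route stops)
layout? {m} {p} route stops = map′
  (λ (l , u , s , b , n) → record { route-linked = l ; route-unique = u ; stops-sorted = s ; stops-bounded = b ; stops-length = n })
  (λ L → let open Layout L in route-linked , route-unique , stops-sorted , stops-bounded , stops-length)
  (linked? Adj? route ×-dec UniqueDec.unique? _≟F_ route ×-dec linked? _≤?_ stops
     ×-dec All.all? (_<? length route) stops ×-dec length stops ≟ℕ suc p)

layoutMappings : (route : List (Fin (suc m))) (stops : List ℕ) → List (Mapping p m)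
layoutMappings route stops with layout? route stops
... | yes L = layoutMapping L ∷ []
... | no _  = []

∈-layoutMappings : {route : List (Fin (suc m))} {stops : List ℕ} → Layout m p route stops →
                   Σ (Layout m p route stops) λ L′ → layoutMapping L′ ∈ layoutMappings route stops
∈-layoutMappings {p = p} {route} {stops} L with layout? {p = p} route stops
... | yes L′ = L′ , here refl
... | no ¬L  = ⊥-elim (¬L L)

candidates : (p m : ℕ) → List (Mapping p m)
candidates p m = concatMap (λ route → concatMap (layoutMappings route) (lists≤ (upTo (suc m)) (suc p)))
                           (lists≤ (allFin (suc m)) (suc m))

∈-candidates : {route : List (Fin (suc m))} {stops : List ℕ} → Layout m p route stops →
               Σ (Layout m p route stops) λ L′ → layoutMapping L′ ∈ candidates p m
∈-candidates {m} {p} {route} {stops} L =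
  let L′ , L′∈ = ∈-layoutMappings L
  in  L′ , ∈-concatMap⁺ _ (lose route∈ (∈-concatMap⁺ _ (lose stops∈ L′∈)))
  where
    open Layout L
    route∈ = ∈-lists≤ (All.universal ∈-allFin route) (Unique⇒length≤ route-unique)
    stops∈ = ∈-lists≤ (All.map (λ s< → ∈-upTo⁺ (<-≤-trans s< (Unique⇒length≤ route-unique))) stops-bounded) (≤-reflexive stops-length)

compressed-candidate : {cN cE : Fin (suc m) → ℕ} (wN wE : Fin (suc m) → ℕ) → 2 ≤ m → (∀ e → 1 ≤ cE e) →
                       {M′ : Mapping p m} → Feasible cN cE M′ →
                       Σ (Mapping p m) λ M → M ∈ candidates p m × (Feasible cN cE M × ElementaryPathMapping M) × cost wN wE M ≤ cost wN wE M′
compressed-candidate wN wE 2≤m cE≥1 {M′} feasible′ =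
  let L , L∈ = ∈-candidates (Compression.layout 2≤m M′)
  in  layoutMapping L , L∈ , (Compression.feasible 2≤m M′ L cE≥1 feasible′ , layoutMapping-elementary L) , Compression.cost-≤ 2≤m M′ L wN wE

lemma2 : (p m : ℕ) → 2 ≤ m
    → (cN cE wN wE : Fin (suc m) → ℕ)
    → (∀ u → 1 ≤ cN u) → (∀ e → 1 ≤ cE e)
    → Σ (Mapping p m) (Feasible cN cE)
    → Σ (Mapping p m) (λ M → Feasible cN cE M × ElementaryPathMapping M
    × ((M′ : Mapping p m) → Feasible cN cE M′ → cost wN wE M ≤ cost wN wE M′))
lemma2 p m 2≤m cN cE wN wE _ cE≥1 (M₀ , feasible₀) =
  let M , M∈ , minimal = minimum-of-dominating {Q = Feasible cN cE} (cost wN wE) good (λ {M′} → dominated {M′}) {M₀} feasible₀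
      _ , feasible , elementary = ∈-filter⁻ good? {xs = candidates p m} M∈
  in  M , feasible , elementary , λ M′ → minimal {M′}
  where
    good? : (M : Mapping p m) → Dec (Feasible cN cE M × ElementaryPathMapping M)
    good? M = (all? (λ u → nodeLoad M u ≤? cN u) ×-dec all? (λ e → edgeLoad M e ≤? cE e)) ×-dec UniqueDec.unique? _≟F_ (walk M)

    good : List (Mapping p m)
    good = filter good? (candidates p m)

    dominated : ∀ {M′} → Feasible cN cE M′ → Σ (Mapping p m) λ M → M ∈ good × cost wN wE M ≤ cost wN wE M′
    dominated {M′} feasible′ =
      let M , M∈ , isGood , cost≤ = compressed-candidate {cN = cN} wN wE 2≤m cE≥1 {M′} feasible′
      in  M , ∈-filter⁺ good? M∈ isGood , cost≤
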